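{- Let $G$ be a finite group and let $Max_G=\{x_1,\dots,x_m\}$ be an essential cyclic set of $G$. If $icn(G)=1$, then $rc(\Gamma_G^e)=1$ if and only if $m=1$. In particular, if $|InMax_G|=1$, then $rc(\Gamma_G^e)=1$ if and only if $G\cong\mathbb{Z}_2$.
   Context: Let $G$ be a finite group with identity $e$. The enhanced power graph $\Gamma_G^e$ has vertex set $G$, two distinct vertices $x,y$ being adjacent iff $x,y\in\langle z\rangle$ for some $z\in G$. For a connected graph $\Gamma$, an edge-colouring $\zeta:E(\Gamma)\to\{1,\dots,k\}$ (not necessarily proper) is a rainbow $k$-colouring if every pair of distinct vertices is joined by a path whose edges have pairwise distinct colours; the rainbow connection number $rc(\Gamma)$ is the minimum such $k$. An essential cyclic set $Max_G=\{x_1,\dots,x_m\}$ is a set of elements of $G$ such that $\langle x_1\rangle,\dots,\langle x_m\rangle$ are pairwise distinct and are exactly the maximal cyclic subgroups of $G$ (so every cyclic subgroup of $G$ lies in some $\langle x_i\rangle$, and $m=|Max_G|$ is the number of maximal cyclic subgroups). The independence cyclic set is $ics(G)=\{x_i\in Max_G:\langle x_i\rangle\cap\langle x_j\rangle=\{e\}\text{ for all }j\neq i\}$ and $icn(G)=|ics(G)|$. $InMax_G$ denotes the set of maximal involutions of $G$, i.e. involutions $t\in G$ such that $\langle t\rangle$ is a maximal cyclic subgroup of $G$. -}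

module Defs where

open import Data.Nat using (ℕ; zero; suc; _≤_; _<_)
open import Data.Fin using (Fin; zero; suc)
open import Data.List using (List; []; _∷_)
open import Data.List.Relation.Unary.Unique.Propositional using (Unique)
open import Data.Product using (Σ; ∃; ∃-syntax; _×_; _,_)
open import Relation.Nullary using (¬_)
open import Relation.Binary.PropositionalEquality using (_≡_; _≢_)
open import Algebra.Structures using (IsGroup)
open import Function.Definitions using (Bijective)

-- Finite groups: a group structure (with propositional equality) on
-- the finite carrier Fin order.  Every finite group is isomorphic to
-- one of this form.

record FinGroup : Set where
  field
    order   : ℕ
    _∙_     : Fin order → Fin order → Fin order
    ε       : Fin order
    _⁻¹     : Fin order → Fin order
    isGroup : IsGroup _≡_ _∙_ ε _⁻¹

module _ (G : FinGroup) where
  open FinGroup G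

  Elt : Set
  Elt = Fin order

  pow : Elt → ℕ → Elt
  pow z zero    = ε
  pow z (suc k) = z ∙ pow z k

  -- x ∈ ⟨ z ⟩   (in a finite group ⟨z⟩ = { z^k : k ∈ ℕ })
  InCyc : Elt → Elt → Set
  InCyc z x = ∃[ k ] (x ≡ pow z k)

  CycSub : Elt → Elt → Set
  CycSub a b = ∀ x → InCyc a x → InCyc b x

  CycEq : Elt → Elt → Set
  CycEq a b = CycSub a b × CycSub b a

  MaxCyclic : Elt → Set
  MaxCyclic a = ∀ z → CycSub a z → CycSub z a

  EssentialCyclicSet : (m : ℕ) → (Fin m → Elt) → Set
  EssentialCyclicSet m xs =
      (∀ i j → i ≢ j → ¬ CycEq (xs i) (xs j))
    × (∀ i → MaxCyclic (xs i))
    × (∀ z → MaxCyclic z → ∃[ i ] CycEq z (xs i))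

  InIcs : (m : ℕ) → (Fin m → Elt) → Fin m → Set
  InIcs m xs i = ∀ j → j ≢ i → ∀ g → InCyc (xs i) g → InCyc (xs j) g → g ≡ ε

  IcnOne : (m : ℕ) → (Fin m → Elt) → Set
  IcnOne m xs = ∃[ i ] (InIcs m xs i × (∀ j → InIcs m xs j → j ≡ i))

  MaxInvolution : Elt → Set
  MaxInvolution t = t ≢ ε × (t ∙ t ≡ ε) × MaxCyclic t

  InMaxOne : Set
  InMaxOne = ∃[ t ] (MaxInvolution t × (∀ s → MaxInvolution s → s ≡ t))

  Adj : Elt → Elt → Set
  Adj x y = x ≢ y × ∃[ z ] (InCyc z x × InCyc z y)

  data Chain : Elt → List Elt → Elt → Set where
    stop : ∀ {x} → Chain x [] x
    step : ∀ {x v vs y} → Adj x v → Chain v vs y → Chain x (v ∷ vs) y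

  -- an edge-colouring with colours Fin k, given on (unordered) pairs,
  -- hence required to be symmetric; values on non-edges are irrelevant
  Colouring : ℕ → Set
  Colouring k = Σ (Elt → Elt → Fin k) (λ ζ → ∀ x y → ζ x y ≡ ζ y x)

  colours : ∀ {k} → (Elt → Elt → Fin k) → Elt → List Elt → List (Fin k)
  colours ζ x []       = []
  colours ζ x (v ∷ vs) = ζ x v ∷ colours ζ v vs

  IsRainbow : ∀ {k} → Colouring k → Set
  IsRainbow (ζ , _) = ∀ x y → x ≢ y →
    ∃[ vs ] (Chain x vs y × Unique (x ∷ vs) × Unique (colours ζ x vs))

  HasRainbowColouring : ℕ → Set
  HasRainbowColouring k = Σ (Colouring k) IsRainbow

  RcIs : ℕ → Set
  RcIs r = 1 ≤ r × HasRainbowColouring r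
         × (∀ k → 1 ≤ k → k < r → ¬ HasRainbowColouring k)

_⊕₂_ : Fin 2 → Fin 2 → Fin 2
zero  ⊕₂ b     = b
suc a ⊕₂ zero  = suc a
suc zero ⊕₂ suc zero = zero

IsoZ2 : FinGroup → Set
IsoZ2 G = ∃[ f ] (Bijective _≡_ _≡_ f × (∀ a b → f (a ∙ b) ≡ f a ⊕₂ f b))
  where open FinGroup G

module Submission where

-- Everything rests on one observation: with a single colour a rainbow path
-- has exactly one edge, so  rc(Γ_G^e) = 1  iff  Γ_G^e is complete.  Two
-- elements are adjacent iff they lie in a common cyclic subgroup, and an
-- element sharing a cyclic subgroup with a generator t of a MAXIMAL cyclic
-- subgroup lies in ⟨t⟩.  Hence, if Γ_G^e is complete, each maximal cyclic
-- subgroup is all of G, so there is only one of them (m = 1; icn(G) = 1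
-- supplies some index, ruling out m = 0); and a maximal involution t then
-- forces G = ⟨t⟩ = {e, t} ≅ ℤ₂.  Conversely, a cyclic group has a complete
-- enhanced power graph; to see that m = 1 makes G cyclic we need that every
-- element lies in some maximal cyclic subgroup.  That is the one genuinely
-- finitary fact: elements have finite order, so membership in ⟨z⟩ is
-- decidable, and climbing strictly along ⟨z⟩ ⊂ ⟨z'⟩ (as subsets of the
-- finite carrier) terminates by well-foundedness of ⊃ on finite subsets.

open import Defs
open import Data.Nat using (ℕ; zero; suc; _+_; _*_; s≤s; z≤n)
open import Data.Nat.Properties using (n<1+n; +-suc; m≤n⇒∃[o]m+o≡n)
open import Data.Nat.DivMod using (_%_; _/_; m≡m%n+[m/n]*n; m%n<n)
open import Data.Fin using (Fin; zero; suc; toℕ; fromℕ<; _≟_)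
open import Data.Fin.Properties using (pigeonhole; any?; all?; ¬∀⟶∃¬; toℕ-fromℕ<)
open import Data.Fin.Subset using (Subset; _∈_; _⊂_; _⊃_)
open import Data.Fin.Subset.Induction using (⊃-wellFounded)
open import Data.Bool using (true)
open import Data.Vec using (tabulate)
open import Data.Vec.Properties using (lookup∘tabulate; lookup⇒[]=; []=⇒lookup)
open import Data.List using ([]; _∷_)
open import Data.List.Relation.Unary.All using ([]; _∷_)
open import Data.List.Relation.Unary.AllPairs using ([]; _∷_)
open import Data.Product using (_×_; _,_; ∃-syntax)
open import Data.Sum using (_⊎_; inj₁; inj₂)
import Data.Sum as Sum
open import Function.Bundles using (_⇔_; mk⇔; Equivalence)
open import Induction.WellFounded using (Acc; acc)
open import Relation.Nullary using (¬_; Dec; yes; no; does; contradiction)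
open import Relation.Nullary.Decidable using (dec-true; _→-dec_)
import Relation.Nullary.Decidable as Dec
open import Relation.Binary.PropositionalEquality
  using (_≡_; _≢_; refl; sym; trans; cong; cong₂; module ≡-Reasoning)
open import Algebra.Bundles using (Group)
open import Algebra.Structures using (IsGroup)
import Algebra.Properties.Group as GroupProperties

Fin1-unique : (a b : Fin 1) → a ≡ b
Fin1-unique zero zero = refl

Fin-singleton : ∀ {m} → Fin m → (∀ (i j : Fin m) → i ≡ j) → m ≡ 1
Fin-singleton {suc zero}    _ _     = refl
Fin-singleton {suc (suc _)} _ allEq = contradiction (allEq zero (suc zero)) λ ()

¬→-split : ∀ {A B : Set} → Dec A → ¬ (A → B) → A × ¬ B
¬→-split (yes a) ¬a→b = a , λ b → ¬a→b λ _ → b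
¬→-split (no ¬a) ¬a→b = contradiction (λ a → contradiction a ¬a) ¬a→b

⊕₂-idempotent⇒zero : ∀ a → a ≡ a ⊕₂ a → a ≡ zero
⊕₂-idempotent⇒zero zero           _ = refl
⊕₂-idempotent⇒zero (suc zero) ()

module _ (G : FinGroup) where
  open FinGroup G
  open IsGroup isGroup using (assoc; identityˡ; identityʳ)

  group : Group _ _
  group = record
    { Carrier = Elt G ; _≈_ = _≡_ ; _∙_ = _∙_ ; ε = ε ; _⁻¹ = _⁻¹ ; isGroup = isGroup }

  open GroupProperties group using (∙-cancelˡ)

  Complete : Set
  Complete = ∀ x y → x ≢ y → Adj G x y

  Generates : Elt G → Set
  Generates z = ∀ x → InCyc G z x

  complete⇒rainbow₁ : Complete → HasRainbowColouring G 1
  complete⇒rainbow₁ complete = ((λ _ _ → zero) , λ _ _ → refl) , λ x y x≢y →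
    y ∷ [] , step (complete x y x≢y) stop , (x≢y ∷ []) ∷ [] ∷ [] , [] ∷ []

  -- With one colour, a rainbow path between distinct vertices is a single edge.
  rainbow₁⇒complete : HasRainbowColouring G 1 → Complete
  rainbow₁⇒complete ((ζ , _) , rainbow) x y x≢y with rainbow x y x≢y
  ... | [] , stop , _ = contradiction refl x≢y
  ... | _ ∷ [] , step x~y stop , _ = x~y
  ... | _ ∷ _ ∷ _ , _ , _ , (c₁≢c₂ ∷ _) ∷ _ = contradiction (Fin1-unique _ _) c₁≢c₂

  -- Minimality of rc = 1 is vacuous, so only the two directions above matter.
  rc₁⇔complete : RcIs G 1 ⇔ Complete
  rc₁⇔complete = mk⇔
    (λ (_ , rainbow₁ , _) → rainbow₁⇒complete rainbow₁)
    (λ complete → s≤s z≤n , complete⇒rainbow₁ complete , λ { zero () _ ; (suc _) _ (s≤s ()) })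

  pow-+ : ∀ z a b → pow G z (a + b) ≡ pow G z a ∙ pow G z b
  pow-+ z zero    b = sym (identityˡ _)
  pow-+ z (suc a) b = trans (cong (z ∙_) (pow-+ z a b)) (sym (assoc z _ _))

  pow-* : ∀ z a b → pow G (pow G z a) b ≡ pow G z (b * a)
  pow-* z a zero    = refl
  pow-* z a (suc b) = trans (cong (pow G z a ∙_) (pow-* z a b)) (sym (pow-+ z a (b * a)))

  pow-ε : ∀ n → pow G ε n ≡ ε
  pow-ε zero    = refl
  pow-ε (suc n) = trans (cong (ε ∙_) (pow-ε n)) (identityˡ ε)

  InCyc-self : ∀ z → InCyc G z z
  InCyc-self z = 1 , sym (identityʳ z)

  InCyc⇒CycSub : ∀ {z a} → InCyc G z a → CycSub G a z
  InCyc⇒CycSub {z} (k , refl) x (n , x≡aⁿ) = n * k , trans x≡aⁿ (pow-* z k n)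

  -- Every element has finite order: by pigeonhole zⁱ = zʲ for some i < j,
  -- and cancelling zⁱ leaves z^(j-i) = ε.
  finiteOrder : ∀ z → ∃[ n ] pow G z (suc n) ≡ ε
  finiteOrder z
    with i , j , i<j , zⁱ≡zʲ ← pigeonhole (n<1+n order) (λ k → pow G z (toℕ k))
    with n , i+1+n≡j ← m≤n⇒∃[o]m+o≡n i<j
    = n , ∙-cancelˡ (pow G z (toℕ i)) _ _ (begin
      pow G z (toℕ i) ∙ pow G z (suc n) ≡⟨ sym (pow-+ z (toℕ i) (suc n)) ⟩
      pow G z (toℕ i + suc n)          ≡⟨ cong (pow G z) (trans (+-suc (toℕ i) n) i+1+n≡j) ⟩
      pow G z (toℕ j)                  ≡⟨ sym zⁱ≡zʲ ⟩
      pow G z (toℕ i)                  ≡⟨ sym (identityʳ _) ⟩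
      pow G z (toℕ i) ∙ ε              ∎)
    where open ≡-Reasoning

  pow-mod : ∀ z n → pow G z (suc n) ≡ ε → ∀ k → pow G z k ≡ pow G z (k % suc n)
  pow-mod z n zᵖ≡ε k = begin
    pow G z k                                 ≡⟨ cong (pow G z) (m≡m%n+[m/n]*n k p) ⟩
    pow G z (k % p + (k / p) * p)             ≡⟨ pow-+ z (k % p) _ ⟩
    pow G z (k % p) ∙ pow G z ((k / p) * p)    ≡⟨ cong (pow G z (k % p) ∙_) (sym (pow-* z p (k / p))) ⟩
    pow G z (k % p) ∙ pow G (pow G z p) (k / p) ≡⟨ cong (λ w → pow G z (k % p) ∙ pow G w (k / p)) zᵖ≡ε ⟩
    pow G z (k % p) ∙ pow G ε (k / p)          ≡⟨ cong (pow G z (k % p) ∙_) (pow-ε (k / p)) ⟩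
    pow G z (k % p) ∙ ε                       ≡⟨ identityʳ _ ⟩
    pow G z (k % p)                           ∎
    where
    open ≡-Reasoning
    p = suc n

  bounded⇔InCyc : ∀ z n → pow G z (suc n) ≡ ε →
    ∀ x → (∃[ k ] x ≡ pow G z (toℕ {suc n} k)) ⇔ InCyc G z x
  bounded⇔InCyc z n zᵖ≡ε x = mk⇔ (λ (k , x≡zᵏ) → toℕ k , x≡zᵏ) reduce
    where
    reduce : InCyc G z x → ∃[ k ] x ≡ pow G z (toℕ {suc n} k)
    reduce (k , x≡zᵏ) = fromℕ< k%p<p , (begin
      x                          ≡⟨ x≡zᵏ ⟩
      pow G z k                  ≡⟨ pow-mod z n zᵖ≡ε k ⟩
      pow G z (k % suc n)        ≡⟨ cong (pow G z) (sym (toℕ-fromℕ< k%p<p)) ⟩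
      pow G z (toℕ (fromℕ< k%p<p)) ∎)
      where
      open ≡-Reasoning
      k%p<p = m%n<n k (suc n)

  InCyc? : ∀ z x → Dec (InCyc G z x)
  InCyc? z x with n , zᵖ≡ε ← finiteOrder z =
    Dec.map (bounded⇔InCyc z n zᵖ≡ε x) (any? λ k → x ≟ pow G z (toℕ k))

  CycSub? : ∀ a b → Dec (CycSub G a b)
  CycSub? a b = all? λ x → InCyc? a x →-dec InCyc? b x

  MaxCyclic? : ∀ z → Dec (MaxCyclic G z)
  MaxCyclic? z = all? λ z' → CycSub? z z' →-dec CycSub? z' z

  -- ⟨z⟩ as a subset of the finite carrier; kept opaque so that type checking
  -- never evaluates the membership decision procedure.
  opaque
    ⟨_⟩ : Elt G → Subset order
    ⟨ z ⟩ = tabulate λ x → does (InCyc? z x)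

    InCyc⇒∈⟨⟩ : ∀ {z x} → InCyc G z x → x ∈ ⟨ z ⟩
    InCyc⇒∈⟨⟩ {z} {x} x∈z = lookup⇒[]= x ⟨ z ⟩
      (trans (lookup∘tabulate _ x) (dec-true (InCyc? z x) x∈z))

    ∈⟨⟩⇒InCyc : ∀ {z x} → x ∈ ⟨ z ⟩ → InCyc G z x
    ∈⟨⟩⇒InCyc {z} {x} x∈⟨z⟩ = witness (InCyc? z x)
      (trans (sym (lookup∘tabulate _ x)) ([]=⇒lookup x∈⟨z⟩))
      where
      witness : (d : Dec (InCyc G z x)) → does d ≡ true → InCyc G z x
      witness (yes x∈z) _ = x∈z

  ¬CycSub⇒witness : ∀ a b → ¬ CycSub G a b → ∃[ x ] (InCyc G a x × ¬ InCyc G b x)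
  ¬CycSub⇒witness a b ¬a⊆b
    with x , ¬[x∈a⇒x∈b] ← ¬∀⟶∃¬ order _ (λ x → InCyc? a x →-dec InCyc? b x) ¬a⊆b
    = x , ¬→-split (InCyc? a x) ¬[x∈a⇒x∈b]

  ¬MaxCyclic⇒witness : ∀ z → ¬ MaxCyclic G z → ∃[ z' ] (CycSub G z z' × ¬ CycSub G z' z)
  ¬MaxCyclic⇒witness z ¬max
    with z' , ¬[z⊆z'⇒z'⊆z] ← ¬∀⟶∃¬ order _ (λ z' → CycSub? z z' →-dec CycSub? z' z) ¬max
    = z' , ¬→-split (CycSub? z z') ¬[z⊆z'⇒z'⊆z]

  proper⇒⊂ : ∀ {a b} → CycSub G a b → ¬ CycSub G b a → ⟨ a ⟩ ⊂ ⟨ b ⟩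
  proper⇒⊂ {a} {b} a⊆b ¬b⊆a with x , x∈b , x∉a ← ¬CycSub⇒witness b a ¬b⊆a =
    (λ y∈⟨a⟩ → InCyc⇒∈⟨⟩ (a⊆b _ (∈⟨⟩⇒InCyc y∈⟨a⟩))) ,
    x , InCyc⇒∈⟨⟩ x∈b , λ x∈⟨a⟩ → x∉a (∈⟨⟩⇒InCyc x∈⟨a⟩)

  -- Climb along strictly larger cyclic subgroups; ⊃ is well founded on
  -- subsets of a finite set, so the climb ends at a maximal one.
  maximalAbove : ∀ z → ∃[ w ] (MaxCyclic G w × CycSub G z w)
  maximalAbove z = climb z (⊃-wellFounded ⟨ z ⟩)
    where
    climb : ∀ z → Acc _⊃_ ⟨ z ⟩ → ∃[ w ] (MaxCyclic G w × CycSub G z w)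
    climb z (acc larger) with MaxCyclic? z
    ... | yes max = z , max , λ _ x∈z → x∈z
    ... | no ¬max =
      let z' , z⊆z' , ¬z'⊆z = ¬MaxCyclic⇒witness z ¬max
          w , maxw , z'⊆w = climb z' (larger (proper⇒⊂ z⊆z' ¬z'⊆z))
      in w , maxw , λ x x∈z → z'⊆w x (z⊆z' x x∈z)

  generates⇒complete : ∀ {z} → Generates z → Complete
  generates⇒complete {z} gen x y x≢y = x≢y , z , gen x , gen y

  -- If Γ_G^e is complete, every maximal cyclic subgroup is all of G: any x
  -- shares a cyclic subgroup ⟨z⟩ with t, and maximality gives ⟨z⟩ = ⟨t⟩.
  complete⇒maxGenerates : Complete → ∀ {t} → MaxCyclic G t → Generates t
  complete⇒maxGenerates complete {t} maxt x with x ≟ t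
  ... | yes refl = InCyc-self x
  ... | no x≢t with _ , z , x∈z , t∈z ← complete x t x≢t = maxt z (InCyc⇒CycSub t∈z) x x∈z

  complete⇒maxUnique : Complete → ∀ {a b} → MaxCyclic G a → MaxCyclic G b → CycEq G a b
  complete⇒maxUnique complete {a} {b} maxa maxb = maxb a b⊆a , b⊆a
    where
    b⊆a : CycSub G b a
    b⊆a = InCyc⇒CycSub (complete⇒maxGenerates complete maxa b)

  essential-complete⇒allEqual : ∀ {m xs} → EssentialCyclicSet G m xs → Complete →
    ∀ i j → i ≡ j
  essential-complete⇒allEqual (distinct , maximal , _) complete i j with i ≟ j
  ... | yes i≡j = i≡j
  ... | no i≢j = contradiction (complete⇒maxUnique complete (maximal i) (maximal j))
                               (distinct i j i≢j)

  essential₁⇒generates : ∀ {xs} → EssentialCyclicSet G 1 xs → Generates (xs zero)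
  essential₁⇒generates (_ , _ , covered) x
    with w , maxw , x⊆w ← maximalAbove x
    with zero , w⊆x₀ , _ ← covered w maxw
    = w⊆x₀ x (x⊆w x (InCyc-self x))

  IsPair : Elt G → Set
  IsPair t = ∀ x → x ≡ ε ⊎ x ≡ t

  involution-powers : ∀ {t} → t ∙ t ≡ ε → ∀ k → pow G t k ≡ ε ⊎ pow G t k ≡ t
  involution-powers tt≡ε zero = inj₁ refl
  involution-powers {t} tt≡ε (suc k) with involution-powers tt≡ε k
  ... | inj₁ tᵏ≡ε = inj₂ (trans (cong (t ∙_) tᵏ≡ε) (identityʳ t))
  ... | inj₂ tᵏ≡t = inj₁ (trans (cong (t ∙_) tᵏ≡t) tt≡ε)

  complete⇒pair : Complete → ∀ {t} → MaxInvolution G t → IsPair t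
  complete⇒pair complete (_ , tt≡ε , maxt) x
    with k , x≡tᵏ ← complete⇒maxGenerates complete maxt x
    = Sum.map (trans x≡tᵏ) (trans x≡tᵏ) (involution-powers tt≡ε k)

  pair⇒generates : ∀ {t} → IsPair t → Generates t
  pair⇒generates {t} pair x with pair x
  ... | inj₁ x≡ε = 0 , x≡ε
  ... | inj₂ x≡t = 1 , trans x≡t (sym (identityʳ t))

  pair⇒IsoZ2 : ∀ {t} → t ≢ ε → t ∙ t ≡ ε → IsPair t → IsoZ2 G
  pair⇒IsoZ2 {t} t≢ε tt≡ε pair = indicator , (injective , surjective) , homomorphism
    where
    indicator : Elt G → Fin 2
    indicator x with x ≟ ε
    ... | yes _ = zero
    ... | no  _ = suc zero

    indicator-ε : indicator ε ≡ zero
    indicator-ε with ε ≟ ε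
    ... | yes _   = refl
    ... | no ε≢ε = contradiction refl ε≢ε

    indicator-t : indicator t ≡ suc zero
    indicator-t with t ≟ ε
    ... | yes t≡ε = contradiction t≡ε t≢ε
    ... | no  _   = refl

    injective : ∀ {a b} → indicator a ≡ indicator b → a ≡ b
    injective {a} {b} eq with pair a | pair b
    ... | inj₁ refl | inj₁ refl = refl
    ... | inj₂ refl | inj₂ refl = refl
    ... | inj₁ refl | inj₂ refl = contradiction (trans (sym indicator-ε) (trans eq indicator-t)) λ ()
    ... | inj₂ refl | inj₁ refl = contradiction (trans (sym indicator-t) (trans eq indicator-ε)) λ ()

    surjective : ∀ y → ∃[ x ] (∀ {z} → z ≡ x → indicator z ≡ y)
    surjective zero       = ε , λ { refl → indicator-ε }
    surjective (suc zero) = t , λ { refl → indicator-t }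

    respects : ∀ {a b c i j} → a ∙ b ≡ c → indicator a ≡ i → indicator b ≡ j →
      indicator c ≡ i ⊕₂ j → indicator (a ∙ b) ≡ indicator a ⊕₂ indicator b
    respects ab≡c a↦i b↦j c↦i⊕j =
      trans (cong indicator ab≡c) (trans c↦i⊕j (sym (cong₂ _⊕₂_ a↦i b↦j)))

    homomorphism : ∀ a b → indicator (a ∙ b) ≡ indicator a ⊕₂ indicator b
    homomorphism a b with pair a | pair b
    ... | inj₁ refl | inj₁ refl = respects (identityˡ ε) indicator-ε indicator-ε indicator-ε
    ... | inj₁ refl | inj₂ refl = respects (identityˡ t) indicator-ε indicator-t indicator-t
    ... | inj₂ refl | inj₁ refl = respects (identityʳ t) indicator-t indicator-ε indicator-t
    ... | inj₂ refl | inj₂ refl = respects tt≡ε indicator-t indicator-t indicator-ε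

  IsoZ2⇒pair : IsoZ2 G → ∃[ t ] IsPair t
  IsoZ2⇒pair (f , (injective , surjective) , homomorphism)
    with t , f[t]≡1 ← surjective (suc zero)
    = t , λ x → classify x
    where
    f[ε]≡0 : f ε ≡ zero
    f[ε]≡0 = ⊕₂-idempotent⇒zero (f ε)
      (trans (cong f (sym (identityˡ ε))) (homomorphism ε ε))

    classify : ∀ x → x ≡ ε ⊎ x ≡ t
    classify x with f x in f[x]
    ... | zero     = inj₁ (injective (trans f[x] (sym f[ε]≡0)))
    ... | suc zero = inj₂ (injective (trans f[x] (sym (f[t]≡1 refl))))

theorem3p1 : (G : FinGroup) (m : ℕ) (xs : Fin m → Elt G) →
    EssentialCyclicSet G m xs → IcnOne G m xs →
    (RcIs G 1 ⇔ m ≡ 1) × (InMaxOne G → (RcIs G 1 ⇔ IsoZ2 G))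
theorem3p1 G m xs essential (i , _) =
  mk⇔ rc₁⇒m≡1 m≡1⇒rc₁ , λ (t , involution , _) → mk⇔ (rc₁⇒IsoZ2 involution) IsoZ2⇒rc₁
  where
  open Equivalence (rc₁⇔complete G) renaming (to to rc₁⇒complete; from to complete⇒rc₁)

  rc₁⇒m≡1 : RcIs G 1 → m ≡ 1
  rc₁⇒m≡1 rc₁ = Fin-singleton i (essential-complete⇒allEqual G essential (rc₁⇒complete rc₁))

  m≡1⇒rc₁ : m ≡ 1 → RcIs G 1
  m≡1⇒rc₁ refl = complete⇒rc₁ (generates⇒complete G (essential₁⇒generates G essential))

  rc₁⇒IsoZ2 : ∀ {t} → MaxInvolution G t → RcIs G 1 → IsoZ2 G
  rc₁⇒IsoZ2 involution@(t≢ε , tt≡ε , _) rc₁ =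
    pair⇒IsoZ2 G t≢ε tt≡ε (complete⇒pair G (rc₁⇒complete rc₁) involution)

  IsoZ2⇒rc₁ : IsoZ2 G → RcIs G 1
  IsoZ2⇒rc₁ iso with _ , pair ← IsoZ2⇒pair G iso =
    complete⇒rc₁ (generates⇒complete G (pair⇒generates G pair))
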